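{- The set of bubbles, with output colour and input colours defined below, together with the composition maps $\circ_i$ of $\mathrm{CNCB}$ (where $\mathfrak{B}_1\circ_i\mathfrak{B}_2$ is considered only when $\mathrm{Out}(\mathfrak{B}_2)=\mathrm{In}_i(\mathfrak{B}_1)$) and two units $\mathbb{1}_1,\mathbb{1}_2$, forms a $2$-coloured operad, denoted $\mathrm{Bulle}$. In particular, whenever $\mathrm{Out}(\mathfrak{B}_2)=\mathrm{In}_i(\mathfrak{B}_1)$, the BNC $\mathfrak{B}_1\circ_i\mathfrak{B}_2$ is again a bubble.
   Context: A bicoloured noncrossing configuration (BNC) of size $n\ge2$ is a regular polygon with vertices $1,\dots,n+1$ (clockwise) with each arc $(i,j)$, $1\le i<j\le n+1$, coloured blue, red or uncoloured, so that no two coloured (blue or red) arcs cross and red arcs are diagonals. The edges are $(i,i+1)$ for $i\in[n]$ (the $i$-th edge), the base is $(1,n+1)$, and the other arcs are diagonals. The operad $\mathrm{CNCB}$ composition $\mathfrak{C}\circ_i\mathfrak{D}$ ($\mathfrak{C}$ of size $n$, $\mathfrak{D}$ of size $m$) is the BNC of size $n+m-1$ obtained by gluing the base of $\mathfrak{D}$ onto the $i$-th edge of $\mathfrak{C}$: vertex $j$ of $\mathfrak{C}$ goes to $j$ if $j\le i$ and to $j+m-1$ otherwise, and vertex $\ell$ of $\mathfrak{D}$ goes to $i+\ell-1$. Arcs other than the glued ones keep their colours, and the arc $(i,i+m)$ is red if the $i$-th edge of $\mathfrak{C}$ and the base of $\mathfrak{D}$ are both uncoloured, blue if both are blue, and uncoloured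 otherwise. All other arcs are uncoloured. A bubble is a BNC of size $n\ge2$ with no coloured (blue or red) diagonal; it is determined by the colours of its edges and base. Its output colour $\mathrm{Out}(\mathfrak{B})$ is $1$ if its base is blue and $2$ otherwise. Its $i$-th input colour $\mathrm{In}_i(\mathfrak{B})$ is $1$ if its $i$-th edge is uncoloured and $2$ if it is blue. The units $\mathbb{1}_c$ ($c=1,2$) are formal elements of arity $1$ with output and input colour $c$. A $2$-coloured operad means a non-symmetric set-theoretic operad whose elements carry an output colour and input colours in $\{1,2\}$, with $x\circ_i y$ defined exactly when $\mathrm{Out}(y)=\mathrm{In}_i(x)$, satisfying the associativity and unit axioms. -}

module Defs where

open import Data.Nat using (ℕ; zero; suc; _+_; _∸_; _≤_; _<_; _≡ᵇ_; _≤ᵇ_)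
open import Data.Bool using (Bool; true; false; if_then_else_; _∧_; _∨_)
open import Data.Product using (_×_; Σ)
open import Data.Unit using (⊤)
open import Data.Empty using (⊥)
open import Relation.Nullary using (¬_)
open import Relation.Binary.PropositionalEquality using (_≡_)

data Col : Set where
  blue red none : Col

data Col2 : Set where
  c₁ c₂ : Col2

-- Raw bicoloured configurations.
-- A configuration of size n has vertices 1,…,n+1; arc i j is the colour
-- of the arc (i,j) and is only meaningful for 1 ≤ i < j ≤ n+1.

record Conf : Set where
  constructor conf
  field
    size : ℕ
    arc  : ℕ → ℕ → Col
open Conf public

ValidArc : ℕ → ℕ → ℕ → Set
ValidArc n i j = (1 ≤ i) × (i < j) × (j ≤ suc n)

-- (i,j) is a diagonal: neither an edge (i,i+1) nor the base (1,n+1)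
IsDiagonal : ℕ → ℕ → ℕ → Set
IsDiagonal n i j = ¬ (j ≡ suc i) × ¬ ((i ≡ 1) × (j ≡ suc n))

Coloured : Col → Set
Coloured c = ¬ (c ≡ none)

Crossing : ℕ → ℕ → ℕ → ℕ → Set
Crossing i j k l = ((i < k) × (k < j) × (j < l)) Data.Sum.⊎ ((k < i) × (i < l) × (l < j))
  where import Data.Sum

record IsBNC (C : Conf) : Set where
  field
    size≥2      : 2 ≤ size C
    red⇒diag    : ∀ i j → ValidArc (size C) i j → arc C i j ≡ red → IsDiagonal (size C) i j
    noncrossing : ∀ i j k l → ValidArc (size C) i j → ValidArc (size C) k l →
                  Coloured (arc C i j) → Coloured (arc C k l) → ¬ Crossing i j k l

record IsBubble (C : Conf) : Set where
  field
    isBNC   : IsBNC C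
    noDiag  : ∀ i j → ValidArc (size C) i j → IsDiagonal (size C) i j → arc C i j ≡ none

_≈ᶜ_ : Conf → Conf → Set
C ≈ᶜ D = (size C ≡ size D) ×
         (∀ i j → ValidArc (size C) i j → arc C i j ≡ arc D i j)

glue : Col → Col → Col
glue none none = red
glue blue blue = blue
glue _    _    = none

_∘ᶜ⟨_⟩_ : Conf → ℕ → Conf → Conf
C ∘ᶜ⟨ i ⟩ D = conf (n + m ∸ 1) newArc
  where
    n = size C
    m = size D
    -- vertex x of the composite lies in the image of C
    inC : ℕ → Bool
    inC x = (x ≤ᵇ i) ∨ ((i + m) ≤ᵇ x)
    -- preimage in C of a vertex in the image of C
    preC : ℕ → ℕ
    preC x = if x ≤ᵇ i then x else x ∸ (m ∸ 1)
    newArc : ℕ → ℕ → Col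
    newArc a b =
      if (a ≡ᵇ i) ∧ (b ≡ᵇ (i + m)) then glue (arc C i (suc i)) (arc D 1 (suc m))
      else if (i ≤ᵇ a) ∧ (b ≤ᵇ (i + m)) then arc D (suc (a ∸ i)) (suc (b ∸ i))
      else if inC a ∧ inC b then arc C (preC a) (preC b)
      else none

-- The candidate operad Bulle: elements are the two formal units and bubbles

data Elt : Set where
  unit : Col2 → Elt
  bnc  : Conf → Elt

𝟙 : Col2 → Elt
𝟙 = unit

IsElt : Elt → Set
IsElt (unit c) = ⊤
IsElt (bnc C)  = IsBubble C

ar : Elt → ℕ
ar (unit _) = 1
ar (bnc C)  = size C

isBlue : Col → Bool
isBlue blue = true
isBlue _    = false

Out : Elt → Col2
Out (unit c) = c
Out (bnc C)  = if isBlue (arc C 1 (suc (size C))) then c₁ else c₂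

-- i-th input colour: 2 if the i-th edge is blue, 1 if it is uncoloured
-- (edges of bubbles are never red)
In : Elt → ℕ → Col2
In (unit c) _ = c
In (bnc C) i  = if isBlue (arc C i (suc i)) then c₂ else c₁

-- partial composition; units act as identities (only used when the
-- colour condition holds and 1 ≤ i ≤ arity)
_∘⟨_⟩_ : Elt → ℕ → Elt → Elt
unit _ ∘⟨ i ⟩ y      = y
bnc C  ∘⟨ i ⟩ unit _ = bnc C
bnc C  ∘⟨ i ⟩ bnc D  = bnc (C ∘ᶜ⟨ i ⟩ D)

_≈_ : Elt → Elt → Set
unit c ≈ unit d = c ≡ d
unit _ ≈ bnc _  = ⊥
bnc _  ≈ unit _ = ⊥
bnc C  ≈ bnc D  = C ≈ᶜ D

record Is2ColouredOperad {A : Set} (El : A → Set) (_≋_ : A → A → Set)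
       (arity : A → ℕ) (out : A → Col2) (inp : A → ℕ → Col2)
       (_∘[_]_ : A → ℕ → A → A) (u : Col2 → A) : Set₁ where
  field
    arity≥1  : ∀ x → El x → 1 ≤ arity x
    unit-el  : ∀ c → El (u c)
    unit-ar  : ∀ c → arity (u c) ≡ 1
    unit-out : ∀ c → out (u c) ≡ c
    unit-in  : ∀ c → inp (u c) 1 ≡ c
    comp-el  : ∀ x y i → El x → El y → 1 ≤ i → i ≤ arity x → out y ≡ inp x i →
               El (x ∘[ i ] y)
    comp-ar  : ∀ x y i → El x → El y → 1 ≤ i → i ≤ arity x → out y ≡ inp x i →
               arity (x ∘[ i ] y) ≡ arity x + arity y ∸ 1
    comp-out : ∀ x y i → El x → El y → 1 ≤ i → i ≤ arity x → out y ≡ inp x i →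
               out (x ∘[ i ] y) ≡ out x
    comp-inˡ : ∀ x y i k → El x → El y → 1 ≤ i → i ≤ arity x → out y ≡ inp x i →
               1 ≤ k → k < i → inp (x ∘[ i ] y) k ≡ inp x k
    comp-inᵐ : ∀ x y i k → El x → El y → 1 ≤ i → i ≤ arity x → out y ≡ inp x i →
               i ≤ k → k < i + arity y → inp (x ∘[ i ] y) k ≡ inp y (suc (k ∸ i))
    comp-inʳ : ∀ x y i k → El x → El y → 1 ≤ i → i ≤ arity x → out y ≡ inp x i →
               i + arity y ≤ k → k ≤ arity x + arity y ∸ 1 →
               inp (x ∘[ i ] y) k ≡ inp x (k + 1 ∸ arity y)
    assoc-seq : ∀ x y z i j → El x → El y → El z →
                1 ≤ i → i ≤ arity x → 1 ≤ j → j ≤ arity y →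
                out y ≡ inp x i → out z ≡ inp y j →
                ((x ∘[ i ] y) ∘[ i + j ∸ 1 ] z) ≋ (x ∘[ i ] (y ∘[ j ] z))
    assoc-par : ∀ x y z i j → El x → El y → El z →
                1 ≤ i → i < j → j ≤ arity x →
                out y ≡ inp x i → out z ≡ inp x j →
                ((x ∘[ i ] y) ∘[ j + arity y ∸ 1 ] z) ≋ ((x ∘[ j ] z) ∘[ i ] y)
    unit-left  : ∀ x → El x → (u (out x) ∘[ 1 ] x) ≋ x
    unit-right : ∀ x i → El x → 1 ≤ i → i ≤ arity x → (x ∘[ i ] u (inp x i)) ≋ x

-- An element of Bulle is determined by its profile: its arity, output colour and
-- input colours (for a bubble: its size and the colours of its base and edges, since its
-- diagonals are uncoloured and its sides are never red). The profile of a composite is the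
-- expected one: the edges of B₁ ∘ᵢ B₂ are those of B₁ with the i-th replaced by those of B₂,
-- and its base is that of B₁. So both associativity laws reduce to comparing input colours
-- position by position, and this only uses the profile equations. The composite of two bubbles
-- is a bubble: every diagonal of it is a diagonal of B₁ or of B₂, hence uncoloured, except the
-- glued arc, which is uncoloured because the colour condition makes exactly one of the two
-- glued sides blue.

module Submission where

open import Defs
open import Data.Nat using (ℕ; _≤_)
open import Data.Product using (_×_)
open import Relation.Binary.PropositionalEquality using (_≡_)
open import Data.Nat hiding (ℕ; _≤_)
open import Data.Nat.Properties
open import Data.Nat.Tactic.RingSolver using (solve-∀)
open import Data.Bool using (true; false; if_then_else_)
open import Data.Bool.Properties using (if-cong)
open import Data.Empty using (⊥-elim)
open import Data.Unit using (tt)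
open import Data.Product using (_,_; proj₁; proj₂)
open import Data.Sum using (_⊎_; inj₁; inj₂)
open import Function using (_∘_)
open import Relation.Binary.PropositionalEquality hiding (_≡_)
open import Relation.Nullary using (¬_; Dec; yes; no)
open import Relation.Nullary.Decidable using (_×-dec_; _⊎-dec_; dec-true; dec-false)

data Cut (a k : ℕ) : Set where
  below : k < a → Cut a k
  above : ∀ t → a + t ≡ k → Cut a k

cut : ∀ a k → Cut a k
cut a k with k <? a
... | yes k<a = below k<a
... | no k≮a = above (k ∸ a) (m+[n∸m]≡n (≮⇒≥ k≮a))

+-right-comm : ∀ a b c → a + b + c ≡ a + c + b
+-right-comm = solve-∀

a+[b+c+d]≡a+b+c+d : ∀ a b c d → a + (b + c + d) ≡ a + b + c + d
a+[b+c+d]≡a+b+c+d = solve-∀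

a+b+c∸[b∸1]≡1+a+c : ∀ a c {b} → 1 ≤ b → a + b + c ∸ (b ∸ 1) ≡ suc (a + c)
a+b+c∸[b∸1]≡1+a+c a c {suc b} _ = trans (cong (_∸ b) (rearrange a b c)) (m+n∸n≡m (suc (a + c)) b)
  where
  rearrange : ∀ a b c → a + suc b + c ≡ suc (a + c) + b
  rearrange = solve-∀

a+b+c+1∸b≡1+a+c : ∀ a b c → a + b + c + 1 ∸ b ≡ suc (a + c)
a+b+c+1∸b≡1+a+c a b c = trans (cong (_∸ b) (rearrange a b c)) (m+n∸n≡m (suc (a + c)) b)
  where
  rearrange : ∀ a b c → a + b + c + 1 ≡ suc (a + c) + b
  rearrange = solve-∀

record IsProfileDetermined {A : Set} (El : A → Set) (_≋_ : A → A → Set)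
       (arity : A → ℕ) (out : A → Col2) (inp : A → ℕ → Col2) (_∘[_]_ : A → ℕ → A → A) : Set where
  field
    arity≥1  : ∀ x → El x → 1 ≤ arity x
    comp-el  : ∀ x y i → El x → El y → 1 ≤ i → i ≤ arity x → out y ≡ inp x i →
               El (x ∘[ i ] y)
    comp-ar  : ∀ x y i → El x → El y → 1 ≤ i → i ≤ arity x → out y ≡ inp x i →
               arity (x ∘[ i ] y) ≡ arity x + arity y ∸ 1
    comp-out : ∀ x y i → El x → El y → 1 ≤ i → i ≤ arity x → out y ≡ inp x i →
               out (x ∘[ i ] y) ≡ out x
    comp-inˡ : ∀ x y i k → El x → El y → 1 ≤ i → i ≤ arity x → out y ≡ inp x i →
               1 ≤ k → k < i → inp (x ∘[ i ] y) k ≡ inp x k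
    comp-inᵐ : ∀ x y i k → El x → El y → 1 ≤ i → i ≤ arity x → out y ≡ inp x i →
               i ≤ k → k < i + arity y → inp (x ∘[ i ] y) k ≡ inp y (suc (k ∸ i))
    comp-inʳ : ∀ x y i k → El x → El y → 1 ≤ i → i ≤ arity x → out y ≡ inp x i →
               i + arity y ≤ k → k ≤ arity x + arity y ∸ 1 →
               inp (x ∘[ i ] y) k ≡ inp x (k + 1 ∸ arity y)
    profile-ext : ∀ x y → El x → El y → arity x ≡ arity y → out x ≡ out y →
                  (∀ k → 1 ≤ k → k ≤ arity x → inp x k ≡ inp y k) → x ≋ y

module ProfileAssociativity {A : Set} {El : A → Set} {_≋_ : A → A → Set}
       {arity : A → ℕ} {out : A → Col2} {inp : A → ℕ → Col2} {_∘[_]_ : A → ℕ → A → A}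
       (P : IsProfileDetermined El _≋_ arity out inp _∘[_]_) where
  open IsProfileDetermined P

  record Composable (x : A) (i : ℕ) (y : A) : Set where
    field
      el-x    : El x
      el-y    : El y
      1≤i     : 1 ≤ i
      i≤ar    : i ≤ arity x
      colours : out y ≡ inp x i

  module _ {x y : A} {i : ℕ} (c : Composable x i y) where
    open Composable c
    private
      n m : ℕ
      n = arity x
      m = arity y
      1≤m : 1 ≤ m
      1≤m = arity≥1 y el-y

    ∘-el : El (x ∘[ i ] y)
    ∘-el = comp-el x y i el-x el-y 1≤i i≤ar colours

    ∘-arity : suc (arity (x ∘[ i ] y)) ≡ n + m
    ∘-arity = trans (cong suc (comp-ar x y i el-x el-y 1≤i i≤ar colours)) (m+[n∸m]≡n (≤-trans 1≤m (m≤n+m m n)))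

    ∘-out : out (x ∘[ i ] y) ≡ out x
    ∘-out = comp-out x y i el-x el-y 1≤i i≤ar colours

    ∘-in-before : ∀ {k} → 1 ≤ k → k < i → inp (x ∘[ i ] y) k ≡ inp x k
    ∘-in-before = comp-inˡ x y i _ el-x el-y 1≤i i≤ar colours

    ∘-in-inside : ∀ {t} → t < m → inp (x ∘[ i ] y) (i + t) ≡ inp y (suc t)
    ∘-in-inside {t} t<m = trans (comp-inᵐ x y i (i + t) el-x el-y 1≤i i≤ar colours (m≤m+n i t) (+-monoʳ-< i t<m))
                                (cong (inp y ∘ suc) (m+n∸m≡n i t))

    ∘-in-after : ∀ {t} → i + m + t ≤ arity (x ∘[ i ] y) → inp (x ∘[ i ] y) (i + m + t) ≡ inp x (suc (i + t))
    ∘-in-after {t} k≤ = trans (comp-inʳ x y i (i + m + t) el-x el-y 1≤i i≤ar colours (m≤m+n (i + m) t)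
                                        (subst (i + m + t ≤_) (comp-ar x y i el-x el-y 1≤i i≤ar colours) k≤))
                              (cong (inp x) (a+b+c+1∸b≡1+a+c i m t))

    after-bound : ∀ {t} → i + m + t ≤ arity (x ∘[ i ] y) → suc (i + t) ≤ n
    after-bound {t} k≤ = +-cancelʳ-≤ m (suc (i + t)) n (subst₂ _≤_ (cong suc (+-right-comm i m t)) ∘-arity (s≤s k≤))

  module Sequential {x y z : A} {i j′ : ℕ} (cxy : Composable x i y) (cyz : Composable y (suc j′) z) where
    private
      XY YZ : A
      XY = x ∘[ i ] y
      YZ = y ∘[ suc j′ ] z
      n m p q : ℕ
      n = arity x
      m = arity y
      p = arity z
      q = arity YZ
      open Composable

    L R : A
    L = XY ∘[ i + j′ ] z
    R = x ∘[ i ] YZ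

    cL : Composable XY (i + j′) z
    cL = record
      { el-x = ∘-el cxy ; el-y = el-y cyz ; 1≤i = ≤-trans (1≤i cxy) (m≤m+n i j′)
      ; i≤ar = ≤-pred (subst₂ _≤_ (+-suc i j′) (sym (∘-arity cxy)) (+-mono-≤ (i≤ar cxy) (i≤ar cyz)))
      ; colours = trans (colours cyz) (sym (∘-in-inside cxy (i≤ar cyz)))
      }

    cR : Composable x i YZ
    cR = record
      { el-x = el-x cxy ; el-y = ∘-el cyz ; 1≤i = 1≤i cxy ; i≤ar = i≤ar cxy
      ; colours = trans (∘-out cyz) (colours cxy)
      }

    arity-L≡R : arity L ≡ arity R
    arity-L≡R = suc-injective (suc-injective (begin
      suc (suc (arity L))   ≡⟨ cong suc (∘-arity cL) ⟩
      suc (arity XY) + p    ≡⟨ cong (_+ p) (∘-arity cxy) ⟩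
      n + m + p             ≡⟨ +-assoc n m p ⟩
      n + (m + p)           ≡⟨ cong (n +_) (sym (∘-arity cyz)) ⟩
      n + suc q             ≡⟨ +-suc n q ⟩
      suc (n + q)           ≡⟨ cong suc (sym (∘-arity cR)) ⟩
      suc (suc (arity R))   ∎))
      where open ≡-Reasoning

    out-L≡R : out L ≡ out R
    out-L≡R = trans (∘-out cL) (trans (∘-out cxy) (sym (∘-out cR)))

    inp-before-z : ∀ {k} → 1 ≤ k → k < i + j′ → inp L k ≡ inp R k
    inp-before-z {k} 1≤k k<i+j′ with cut i k
    ... | below k<i = begin
      inp L k    ≡⟨ ∘-in-before cL 1≤k k<i+j′ ⟩
      inp XY k   ≡⟨ ∘-in-before cxy 1≤k k<i ⟩
      inp x k    ≡⟨ ∘-in-before cR 1≤k k<i ⟨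
      inp R k    ∎
      where open ≡-Reasoning
    ... | above t refl = begin
      inp L (i + t)      ≡⟨ ∘-in-before cL 1≤k k<i+j′ ⟩
      inp XY (i + t)     ≡⟨ ∘-in-inside cxy (<-trans t<j′ (i≤ar cyz)) ⟩
      inp y (suc t)      ≡⟨ ∘-in-before cyz (s≤s z≤n) (s≤s t<j′) ⟨
      inp YZ (suc t)     ≡⟨ ∘-in-inside cR (<-≤-trans t<j′ j′≤q) ⟨
      inp R (i + t)      ∎
      where
      open ≡-Reasoning
      t<j′ : t < j′
      t<j′ = +-cancelˡ-< i t j′ k<i+j′
      j′≤q : j′ ≤ q
      j′≤q = ≤-pred (subst (suc j′ ≤_) (sym (∘-arity cyz)) (≤-trans (i≤ar cyz) (m≤m+n m p)))

    inp-z : ∀ {s} → s < p → inp L (i + j′ + s) ≡ inp R (i + j′ + s)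
    inp-z {s} s<p = begin
      inp L (i + j′ + s)     ≡⟨ ∘-in-inside cL s<p ⟩
      inp z (suc s)          ≡⟨ ∘-in-inside cyz s<p ⟨
      inp YZ (suc j′ + s)    ≡⟨ ∘-in-inside cR j′+s<q ⟨
      inp R (i + (j′ + s))   ≡⟨ cong (inp R) (+-assoc i j′ s) ⟨
      inp R (i + j′ + s)     ∎
      where
      open ≡-Reasoning
      j′+s<q : j′ + s < q
      j′+s<q = ≤-pred (subst₂ _≤_ (cong suc (+-suc j′ s)) (sym (∘-arity cyz)) (+-mono-≤ (i≤ar cyz) s<p))

    inp-after-z-within-y : ∀ {u} → suc (j′ + u) < m → i + j′ + p + u ≤ arity L →
                           inp L (i + j′ + p + u) ≡ inp R (i + j′ + p + u)
    inp-after-z-within-y {u} 1+j′+u<m k≤ = begin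
      inp L (i + j′ + p + u)       ≡⟨ ∘-in-after cL k≤ ⟩
      inp XY (suc (i + j′ + u))    ≡⟨ cong (inp XY) (shift i j′ u) ⟩
      inp XY (i + suc (j′ + u))    ≡⟨ ∘-in-inside cxy 1+j′+u<m ⟩
      inp y (suc (suc (j′ + u)))   ≡⟨ ∘-in-after cyz j′+p+u<q ⟨
      inp YZ (suc j′ + p + u)      ≡⟨ ∘-in-inside cR j′+p+u<q ⟨
      inp R (i + (j′ + p + u))     ≡⟨ cong (inp R) (a+[b+c+d]≡a+b+c+d i j′ p u) ⟩
      inp R (i + j′ + p + u)       ∎
      where
      open ≡-Reasoning
      shift : ∀ a b c → suc (a + b + c) ≡ a + suc (b + c)
      shift = solve-∀
      swap : ∀ a b c → suc (suc (a + b)) + c ≡ suc (suc (a + c + b))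
      swap = solve-∀
      j′+p+u<q : j′ + p + u < q
      j′+p+u<q = ≤-pred (subst₂ _≤_ (swap j′ u p) (sym (∘-arity cyz)) (+-monoˡ-≤ p 1+j′+u<m))

    inp-after-z-beyond-y : ∀ {u w} → m + w ≡ suc (j′ + u) → i + j′ + p + u ≤ arity L →
                           inp L (i + j′ + p + u) ≡ inp R (i + j′ + p + u)
    inp-after-z-beyond-y {u} {w} m+w≡1+j′+u k≤ = begin
      inp L (i + j′ + p + u)       ≡⟨ ∘-in-after cL k≤ ⟩
      inp XY (suc (i + j′ + u))    ≡⟨ cong (inp XY) position-in-XY ⟩
      inp XY (i + m + w)           ≡⟨ ∘-in-after cxy (subst (_≤ arity XY) position-in-XY (after-bound cL k≤)) ⟩
      inp x (suc (i + w))          ≡⟨ ∘-in-after cR (subst₂ _≤_ (sym position-in-R) arity-L≡R k≤) ⟨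
      inp R (i + q + w)            ≡⟨ cong (inp R) position-in-R ⟩
      inp R (i + j′ + p + u)       ∎
      where
      open ≡-Reasoning
      position-in-XY : suc (i + j′ + u) ≡ i + m + w
      position-in-XY = begin
        suc (i + j′ + u)   ≡⟨ cong suc (+-assoc i j′ u) ⟩
        suc (i + (j′ + u)) ≡⟨ +-suc i (j′ + u) ⟨
        i + suc (j′ + u)   ≡⟨ cong (i +_) m+w≡1+j′+u ⟨
        i + (m + w)        ≡⟨ +-assoc i m w ⟨
        i + m + w          ∎
      q+w≡j′+p+u : q + w ≡ j′ + p + u
      q+w≡j′+p+u = suc-injective (begin
        suc q + w          ≡⟨ cong (_+ w) (∘-arity cyz) ⟩
        m + p + w          ≡⟨ +-right-comm m p w ⟩
        m + w + p          ≡⟨ cong (_+ p) m+w≡1+j′+u ⟩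
        suc (j′ + u) + p   ≡⟨ cong suc (+-right-comm j′ u p) ⟩
        suc (j′ + p + u)   ∎)
      position-in-R : i + q + w ≡ i + j′ + p + u
      position-in-R = begin
        i + q + w          ≡⟨ +-assoc i q w ⟩
        i + (q + w)        ≡⟨ cong (i +_) q+w≡j′+p+u ⟩
        i + (j′ + p + u)   ≡⟨ a+[b+c+d]≡a+b+c+d i j′ p u ⟩
        i + j′ + p + u     ∎

    inp-after-z : ∀ {u} → i + j′ + p + u ≤ arity L → inp L (i + j′ + p + u) ≡ inp R (i + j′ + p + u)
    inp-after-z {u} k≤ with cut m (suc (j′ + u))
    ... | below 1+j′+u<m      = inp-after-z-within-y 1+j′+u<m k≤
    ... | above w m+w≡1+j′+u     = inp-after-z-beyond-y m+w≡1+j′+u k≤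

    inp-L≡R : ∀ k → 1 ≤ k → k ≤ arity L → inp L k ≡ inp R k
    inp-L≡R k 1≤k k≤ with cut (i + j′) k
    ... | below k<i+j′ = inp-before-z 1≤k k<i+j′
    ... | above s refl with cut p s
    ...   | below s<p    = inp-z s<p
    ...   | above u refl = subst (λ k → inp L k ≡ inp R k) (+-assoc (i + j′) p u)
                                 (inp-after-z (subst (_≤ arity L) (sym (+-assoc (i + j′) p u)) k≤))

    assoc : L ≋ R
    assoc = profile-ext L R (∘-el cL) (∘-el cR) arity-L≡R out-L≡R inp-L≡R

  module Parallel {x y z : A} {i w : ℕ} (cxy : Composable x i y) (cxz : Composable x (suc (i + w)) z) where
    private
      n m p j : ℕ
      n = arity x
      m = arity y
      p = arity z
      j = suc (i + w)
      XY XZ : A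
      XY = x ∘[ i ] y
      XZ = x ∘[ j ] z
      open Composable

    L R : A
    L = XY ∘[ i + m + w ] z
    R = XZ ∘[ i ] y

    i≤i+m+w : i ≤ i + m + w
    i≤i+m+w = ≤-trans (m≤m+n i m) (m≤m+n (i + m) w)

    i+m+w≤arity-XY : i + m + w ≤ arity XY
    i+m+w≤arity-XY = ≤-pred (subst₂ _≤_ (cong suc (+-right-comm i w m)) (sym (∘-arity cxy)) (+-monoˡ-≤ m (i≤ar cxz)))

    cL : Composable XY (i + m + w) z
    cL = record
      { el-x = ∘-el cxy ; el-y = el-y cxz ; 1≤i = ≤-trans (1≤i cxy) i≤i+m+w
      ; i≤ar = i+m+w≤arity-XY
      ; colours = trans (colours cxz) (sym (∘-in-after cxy i+m+w≤arity-XY))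
      }

    cR : Composable XZ i y
    cR = record
      { el-x = ∘-el cxz ; el-y = el-y cxy ; 1≤i = 1≤i cxy
      ; i≤ar = ≤-pred (subst (suc i ≤_) (sym (∘-arity cxz)) (≤-trans (≤-trans i<j (i≤ar cxz)) (m≤m+n n p)))
      ; colours = trans (colours cxy) (sym (∘-in-before cxz (1≤i cxy) i<j))
      }
      where
      i<j : i < j
      i<j = s≤s (m≤m+n i w)

    arity-L≡R : arity L ≡ arity R
    arity-L≡R = suc-injective (suc-injective (begin
      suc (suc (arity L))   ≡⟨ cong suc (∘-arity cL) ⟩
      suc (arity XY) + p    ≡⟨ cong (_+ p) (∘-arity cxy) ⟩
      n + m + p             ≡⟨ +-right-comm n m p ⟩
      n + p + m             ≡⟨ cong (_+ m) (∘-arity cxz) ⟨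
      suc (arity XZ) + m    ≡⟨ cong suc (∘-arity cR) ⟨
      suc (suc (arity R))   ∎))
      where open ≡-Reasoning

    out-L≡R : out L ≡ out R
    out-L≡R = trans (∘-out cL) (trans (∘-out cxy) (sym (trans (∘-out cR) (∘-out cxz))))

    inp-before-y : ∀ {k} → 1 ≤ k → k < i → inp L k ≡ inp R k
    inp-before-y {k} 1≤k k<i = begin
      inp L k    ≡⟨ ∘-in-before cL 1≤k (<-≤-trans k<i i≤i+m+w) ⟩
      inp XY k   ≡⟨ ∘-in-before cxy 1≤k k<i ⟩
      inp x k    ≡⟨ ∘-in-before cxz 1≤k (<-trans k<i (s≤s (m≤m+n i w))) ⟨
      inp XZ k   ≡⟨ ∘-in-before cR 1≤k k<i ⟨
      inp R k    ∎
      where open ≡-Reasoning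

    inp-y : ∀ {t} → t < m → inp L (i + t) ≡ inp R (i + t)
    inp-y {t} t<m = begin
      inp L (i + t)    ≡⟨ ∘-in-before cL (≤-trans (1≤i cxy) (m≤m+n i t)) (<-≤-trans (+-monoʳ-< i t<m) (m≤m+n (i + m) w)) ⟩
      inp XY (i + t)   ≡⟨ ∘-in-inside cxy t<m ⟩
      inp y (suc t)    ≡⟨ ∘-in-inside cR t<m ⟨
      inp R (i + t)    ∎
      where open ≡-Reasoning

    inp-between : ∀ {t} → t < w → i + m + t ≤ arity L → inp L (i + m + t) ≡ inp R (i + m + t)
    inp-between {t} t<w k≤ = begin
      inp L (i + m + t)     ≡⟨ ∘-in-before cL (≤-trans (1≤i cxy) (≤-trans (m≤m+n i m) (m≤m+n (i + m) t))) k<i+m+w ⟩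
      inp XY (i + m + t)    ≡⟨ ∘-in-after cxy (≤-trans (<⇒≤ k<i+m+w) i+m+w≤arity-XY) ⟩
      inp x (suc (i + t))   ≡⟨ ∘-in-before cxz (s≤s z≤n) (s≤s (+-monoʳ-< i t<w)) ⟨
      inp XZ (suc (i + t))  ≡⟨ ∘-in-after cR (subst (i + m + t ≤_) arity-L≡R k≤) ⟨
      inp R (i + m + t)     ∎
      where
      open ≡-Reasoning
      k<i+m+w : i + m + t < i + m + w
      k<i+m+w = +-monoʳ-< (i + m) t<w

    inp-z : ∀ {s} → s < p → i + m + w + s ≤ arity L → inp L (i + m + w + s) ≡ inp R (i + m + w + s)
    inp-z {s} s<p k≤ = begin
      inp L (i + m + w + s)       ≡⟨ ∘-in-inside cL s<p ⟩
      inp z (suc s)               ≡⟨ ∘-in-inside cxz s<p ⟨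
      inp XZ (j + s)              ≡⟨ cong (inp XZ ∘ suc) (+-assoc i w s) ⟩
      inp XZ (suc (i + (w + s)))  ≡⟨ ∘-in-after cR (subst₂ _≤_ (+-assoc (i + m) w s) arity-L≡R k≤) ⟨
      inp R (i + m + (w + s))     ≡⟨ cong (inp R) (+-assoc (i + m) w s) ⟨
      inp R (i + m + w + s)       ∎
      where open ≡-Reasoning

    inp-after-z : ∀ {u} → i + m + w + p + u ≤ arity L → inp L (i + m + w + p + u) ≡ inp R (i + m + w + p + u)
    inp-after-z {u} k≤ = begin
      inp L (i + m + w + p + u)         ≡⟨ ∘-in-after cL k≤ ⟩
      inp XY (suc (i + m + w + u))      ≡⟨ cong (inp XY) (position-in-XY i m w u) ⟩
      inp XY (i + m + (w + suc u))      ≡⟨ ∘-in-after cxy (subst (_≤ arity XY) (position-in-XY i m w u) (after-bound cL k≤)) ⟩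
      inp x (suc (i + (w + suc u)))     ≡⟨ cong (inp x) (position-in-x i w u) ⟩
      inp x (suc (j + u))               ≡⟨ ∘-in-after cxz (subst (_≤ arity XZ) (position-in-XZ i w p u) (after-bound cR k≤R)) ⟨
      inp XZ (j + p + u)                ≡⟨ cong (inp XZ) (position-in-XZ i w p u) ⟨
      inp XZ (suc (i + (w + p + u)))    ≡⟨ ∘-in-after cR k≤R ⟨
      inp R (i + m + (w + p + u))       ≡⟨ cong (inp R) (position-in-R i m w p u) ⟨
      inp R (i + m + w + p + u)         ∎
      where
      open ≡-Reasoning
      position-in-XY : ∀ i m w u → suc (i + m + w + u) ≡ i + m + (w + suc u)
      position-in-XY = solve-∀
      position-in-x : ∀ i w u → suc (i + (w + suc u)) ≡ suc (suc (i + w) + u)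
      position-in-x = solve-∀
      position-in-XZ : ∀ i w p u → suc (i + (w + p + u)) ≡ suc (i + w) + p + u
      position-in-XZ = solve-∀
      position-in-R : ∀ i m w p u → i + m + w + p + u ≡ i + m + (w + p + u)
      position-in-R = solve-∀
      k≤R : i + m + (w + p + u) ≤ arity R
      k≤R = subst₂ _≤_ (position-in-R i m w p u) arity-L≡R k≤

    inp-L≡R : ∀ k → 1 ≤ k → k ≤ arity L → inp L k ≡ inp R k
    inp-L≡R k 1≤k k≤ with cut (i + m + w) k
    ... | below k<i+m+w with cut (i + m) k
    ...   | above t refl = inp-between (+-cancelˡ-< (i + m) t w k<i+m+w) k≤
    ...   | below k<i+m with cut i k
    ...     | below k<i    = inp-before-y 1≤k k<i
    ...     | above t refl = inp-y (+-cancelˡ-< i t m k<i+m)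
    inp-L≡R k 1≤k k≤ | above s refl with cut p s
    ... | below s<p    = inp-z s<p k≤
    ... | above u refl = subst (λ k → inp L k ≡ inp R k) (+-assoc (i + m + w) p u)
                               (inp-after-z (subst (_≤ arity L) (sym (+-assoc (i + m + w) p u)) k≤))

    assoc : L ≋ R
    assoc = profile-ext L R (∘-el cL) (∘-el cR) arity-L≡R out-L≡R inp-L≡R

  assoc-seq : ∀ x y z i j → El x → El y → El z →
              1 ≤ i → i ≤ arity x → 1 ≤ j → j ≤ arity y →
              out y ≡ inp x i → out z ≡ inp y j →
              ((x ∘[ i ] y) ∘[ i + j ∸ 1 ] z) ≋ (x ∘[ i ] (y ∘[ j ] z))
  assoc-seq x y z i (suc j′) el-x el-y el-z 1≤i i≤n _ j≤m colours-xy colours-yz =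
    subst (λ k → ((x ∘[ i ] y) ∘[ k ] z) ≋ (x ∘[ i ] (y ∘[ suc j′ ] z))) (cong (_∸ 1) (sym (+-suc i j′)))
          (Sequential.assoc (record { el-x = el-x ; el-y = el-y ; 1≤i = 1≤i ; i≤ar = i≤n ; colours = colours-xy })
                            (record { el-x = el-y ; el-y = el-z ; 1≤i = s≤s z≤n ; i≤ar = j≤m ; colours = colours-yz }))

  assoc-par : ∀ x y z i j → El x → El y → El z →
              1 ≤ i → i < j → j ≤ arity x →
              out y ≡ inp x i → out z ≡ inp x j →
              ((x ∘[ i ] y) ∘[ j + arity y ∸ 1 ] z) ≋ ((x ∘[ j ] z) ∘[ i ] y)
  assoc-par x y z i j el-x el-y el-z 1≤i i<j j≤n colours-xy colours-xz with m≤n⇒∃[o]m+o≡n i<j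
  ... | w , refl =
    subst (λ k → ((x ∘[ i ] y) ∘[ k ] z) ≋ ((x ∘[ j ] z) ∘[ i ] y)) (sym (+-right-comm i w (arity y)))
          (Parallel.assoc (record { el-x = el-x ; el-y = el-y ; 1≤i = 1≤i ; i≤ar = ≤-trans (<⇒≤ i<j) j≤n ; colours = colours-xy })
                          (record { el-x = el-x ; el-y = el-z ; 1≤i = s≤s z≤n ; i≤ar = j≤n ; colours = colours-xz }))

IsSide : ℕ → ℕ → ℕ → Set
IsSide n i j = (j ≡ suc i) ⊎ ((i ≡ 1) × (j ≡ suc n))

diagonal-or-side : ∀ n i j → IsDiagonal n i j ⊎ IsSide n i j
diagonal-or-side n i j with (j ≟ suc i) ⊎-dec ((i ≟ 1) ×-dec (j ≟ suc n))
... | yes side = inj₂ side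
... | no ¬side = inj₁ (¬side ∘ inj₁ , ¬side ∘ inj₂)

side-noncrossing : ∀ {n i j k l} → IsSide n i j → ValidArc n k l → ¬ Crossing i j k l
side-noncrossing (inj₁ refl)         _           (inj₁ (i<k , k<j , _)) = <⇒≱ i<k (≤-pred k<j)
side-noncrossing (inj₁ refl)         _           (inj₂ (_ , i<l , l<j)) = <⇒≱ i<l (≤-pred l<j)
side-noncrossing (inj₂ (refl , refl)) (_ , _ , l≤) (inj₁ (_ , _ , j<l))   = <⇒≱ j<l l≤
side-noncrossing (inj₂ (refl , refl)) (1≤k , _ , _) (inj₂ (k<i , _ , _))  = <⇒≱ k<i 1≤k

-- All coloured arcs are then sides, and a side crosses no arc.
isBubble : (C : Conf) → 2 ≤ size C →
           (∀ i j → ValidArc (size C) i j → IsDiagonal (size C) i j → arc C i j ≡ none) →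
           (∀ k → 1 ≤ k → k ≤ size C → arc C k (suc k) ≢ red) →
           arc C 1 (suc (size C)) ≢ red →
           IsBubble C
isBubble C 2≤n noDiag edge≢red base≢red = record
  { isBNC  = record
    { size≥2      = 2≤n
    ; red⇒diag    = red⇒diag
    ; noncrossing = λ i j k l v w c _ → side-noncrossing (coloured⇒side i j v c) w
    }
  ; noDiag = noDiag
  }
  where
  n : ℕ
  n = size C
  red⇒diag : ∀ i j → ValidArc n i j → arc C i j ≡ red → IsDiagonal n i j
  red⇒diag i j v isRed with diagonal-or-side n i j
  ... | inj₁ diag = diag
  red⇒diag i _ (1≤i , _ , i<n) isRed | inj₂ (inj₁ refl) = ⊥-elim (edge≢red i 1≤i (≤-pred i<n) isRed)
  red⇒diag _ _ _ isRed | inj₂ (inj₂ (refl , refl)) = ⊥-elim (base≢red isRed)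
  coloured⇒side : ∀ i j → ValidArc n i j → Coloured (arc C i j) → IsSide n i j
  coloured⇒side i j v c with diagonal-or-side n i j
  ... | inj₁ diag = ⊥-elim (c (noDiag i j v diag))
  ... | inj₂ side = side

module _ {C : Conf} (b : IsBubble C) where
  open IsBNC (IsBubble.isBNC b)

  bubble-edge≢red : ∀ k → 1 ≤ k → k ≤ size C → arc C k (suc k) ≢ red
  bubble-edge≢red k 1≤k k≤n isRed = proj₁ (red⇒diag k (suc k) (1≤k , ≤-refl , s≤s k≤n) isRed) refl

  bubble-base≢red : arc C 1 (suc (size C)) ≢ red
  bubble-base≢red isRed = proj₂ (red⇒diag 1 (suc (size C)) (≤-refl , s≤s (<⇒≤ size≥2) , ≤-refl) isRed) (refl , refl)

isBlue-injective : ∀ {c d} → c ≢ red → d ≢ red → isBlue c ≡ isBlue d → c ≡ d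
isBlue-injective {blue} {blue} _ _ _ = refl
isBlue-injective {none} {none} _ _ _ = refl
isBlue-injective {red}  c≢red _ _ = ⊥-elim (c≢red refl)
isBlue-injective {_}  {red} _ d≢red _ = ⊥-elim (d≢red refl)
isBlue-injective {blue} {none} _ _ ()
isBlue-injective {none} {blue} _ _ ()

bubble-ext : ∀ {C D} → IsBubble C → IsBubble D → size C ≡ size D →
             isBlue (arc C 1 (suc (size C))) ≡ isBlue (arc D 1 (suc (size D))) →
             (∀ k → 1 ≤ k → k ≤ size C → isBlue (arc C k (suc k)) ≡ isBlue (arc D k (suc k))) →
             C ≈ᶜ D
bubble-ext {C} {D} bC bD refl base edges = refl , same
  where
  same : ∀ i j → ValidArc (size C) i j → arc C i j ≡ arc D i j
  same i j v with diagonal-or-side (size C) i j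
  ... | inj₁ diag = trans (IsBubble.noDiag bC i j v diag) (sym (IsBubble.noDiag bD i j v diag))
  same i _ (1≤i , _ , i<n) | inj₂ (inj₁ refl) =
    isBlue-injective (bubble-edge≢red bC i 1≤i (≤-pred i<n)) (bubble-edge≢red bD i 1≤i (≤-pred i<n))
                     (edges i 1≤i (≤-pred i<n))
  same _ _ _ | inj₂ (inj₂ (refl , refl)) = isBlue-injective (bubble-base≢red bC) (bubble-base≢red bD) base

module Composite (C D : Conf) (i : ℕ) where
  private
    m : ℕ
    m = size D

  Glued : ℕ → ℕ → Set
  Glued a b = (a ≡ i) × (b ≡ i + m)

  Inner : ℕ → ℕ → Set
  Inner a b = (i ≤ a) × (b ≤ i + m)

  Outer : ℕ → Set
  Outer x = (x ≤ i) ⊎ (i + m ≤ x)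

  -- does (glued? a b) is by definition the boolean test of _∘ᶜ⟨_⟩_, and similarly below,
  -- so dec-true and dec-false select the branches of the composite's arc function.
  glued? : ∀ a b → Dec (Glued a b)
  glued? a b = (a ≟ i) ×-dec (b ≟ i + m)

  inner? : ∀ a b → Dec (Inner a b)
  inner? a b = (i ≤? a) ×-dec (b ≤? i + m)

  outer? : ∀ x → Dec (Outer x)
  outer? x = (x ≤? i) ⊎-dec (i + m ≤? x)

  -- agrees with preC in the definition of _∘ᶜ⟨_⟩_
  preimage : ℕ → ℕ
  preimage x = if x ≤ᵇ i then x else x ∸ (m ∸ 1)

  private
    comp : Conf
    comp = C ∘ᶜ⟨ i ⟩ D

  arc-glued : ∀ {a b} → Glued a b → arc comp a b ≡ glue (arc C i (suc i)) (arc D 1 (suc m))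
  arc-glued {a} {b} g rewrite dec-true (glued? a b) g = refl

  arc-inner : ∀ {a b} → ¬ Glued a b → Inner a b → arc comp a b ≡ arc D (suc (a ∸ i)) (suc (b ∸ i))
  arc-inner {a} {b} ¬g inn rewrite dec-false (glued? a b) ¬g | dec-true (inner? a b) inn = refl

  arc-outer : ∀ {a b} → ¬ Glued a b → ¬ Inner a b → Outer a → Outer b →
              arc comp a b ≡ arc C (preimage a) (preimage b)
  arc-outer {a} {b} ¬g ¬inn oa ob
    rewrite dec-false (glued? a b) ¬g | dec-false (inner? a b) ¬inn
          | dec-true (outer? a ×-dec outer? b) (oa , ob) = refl

  arc-elsewhere : ∀ {a b} → ¬ Glued a b → ¬ Inner a b → ¬ (Outer a × Outer b) → arc comp a b ≡ none
  arc-elsewhere {a} {b} ¬g ¬inn ¬out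
    rewrite dec-false (glued? a b) ¬g | dec-false (inner? a b) ¬inn
          | dec-false (outer? a ×-dec outer? b) ¬out = refl

  preimage-before : ∀ {x} → x ≤ i → preimage x ≡ x
  preimage-before {x} x≤i rewrite dec-true (x ≤? i) x≤i = refl

  i<i+m+t : 1 ≤ m → ∀ t → i < i + m + t
  i<i+m+t 1≤m t = <-≤-trans (m<m+n i 1≤m) (m≤m+n (i + m) t)

  preimage-after : 1 ≤ m → ∀ t → preimage (i + m + t) ≡ suc (i + t)
  preimage-after 1≤m t = begin
    preimage (i + m + t)  ≡⟨ if-cong (dec-false (i + m + t ≤? i) (<⇒≱ (i<i+m+t 1≤m t))) ⟩
    i + m + t ∸ (m ∸ 1)   ≡⟨ a+b+c∸[b∸1]≡1+a+c i t 1≤m ⟩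
    suc (i + t)           ∎
    where open ≡-Reasoning

  edge-before : ∀ {k} → k < i → arc comp k (suc k) ≡ arc C k (suc k)
  edge-before {k} k<i = begin
    arc comp k (suc k)                      ≡⟨ arc-outer (<⇒≢ k<i ∘ proj₁) (<⇒≱ k<i ∘ proj₁)
                                                         (inj₁ (<⇒≤ k<i)) (inj₁ k<i) ⟩
    arc C (preimage k) (preimage (suc k))   ≡⟨ cong₂ (arc C) (preimage-before (<⇒≤ k<i)) (preimage-before k<i) ⟩
    arc C k (suc k)                         ∎
    where open ≡-Reasoning

  edge-inner : 2 ≤ m → ∀ {t} → t < m → arc comp (i + t) (suc (i + t)) ≡ arc D (suc t) (suc (suc t))
  edge-inner 2≤m {t} t<m = begin
    arc comp (i + t) (suc (i + t))                        ≡⟨ arc-inner ¬glued (m≤m+n i t , +-monoʳ-< i t<m) ⟩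
    arc D (suc (i + t ∸ i)) (suc (suc (i + t) ∸ i))       ≡⟨ cong₂ (λ a b → arc D (suc a) (suc b)) (m+n∸m≡n i t) 1+i+t∸i≡1+t ⟩
    arc D (suc t) (suc (suc t))                           ∎
    where
    open ≡-Reasoning
    1+i+t∸i≡1+t : suc (i + t) ∸ i ≡ suc t
    1+i+t∸i≡1+t = trans (cong (_∸ i) (sym (+-suc i t))) (m+n∸m≡n i (suc t))
    ¬glued : ¬ Glued (i + t) (suc (i + t))
    ¬glued (i+t≡i , 1+i+t≡i+m) =
      <⇒≢ 2≤m (+-cancelˡ-≡ i 1 m (trans (+-comm i 1) (trans (cong suc (sym i+t≡i)) 1+i+t≡i+m)))

  edge-after : 1 ≤ m → ∀ t → arc comp (i + m + t) (suc (i + m + t)) ≡ arc C (suc (i + t)) (suc (suc (i + t)))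
  edge-after 1≤m t = begin
    arc comp (i + m + t) (suc (i + m + t))                   ≡⟨ arc-outer ¬glued ¬inner (inj₂ i+m≤) (inj₂ (m≤n⇒m≤1+n i+m≤)) ⟩
    arc C (preimage (i + m + t)) (preimage (suc (i + m + t))) ≡⟨ cong₂ (arc C) (preimage-after 1≤m t) preimage-suc ⟩
    arc C (suc (i + t)) (suc (suc (i + t)))                  ∎
    where
    open ≡-Reasoning
    i+m≤ : i + m ≤ i + m + t
    i+m≤ = m≤m+n (i + m) t
    ¬glued : ¬ Glued (i + m + t) (suc (i + m + t))
    ¬glued = <⇒≢ (i<i+m+t 1≤m t) ∘ sym ∘ proj₁
    ¬inner : ¬ Inner (i + m + t) (suc (i + m + t))
    ¬inner = <⇒≱ (s≤s i+m≤) ∘ proj₂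
    preimage-suc : preimage (suc (i + m + t)) ≡ suc (suc (i + t))
    preimage-suc = begin
      preimage (suc (i + m + t))  ≡⟨ cong preimage (sym (+-suc (i + m) t)) ⟩
      preimage (i + m + suc t)    ≡⟨ preimage-after 1≤m (suc t) ⟩
      suc (i + suc t)             ≡⟨ cong suc (+-suc i t) ⟩
      suc (suc (i + t))           ∎

  base-arc : 2 ≤ size C → 1 ≤ i → i ≤ size C → 1 ≤ m → arc comp 1 (size C + m) ≡ arc C 1 (suc (size C))
  base-arc 2≤n 1≤i i≤n 1≤m = begin
    arc comp 1 (n + m)                         ≡⟨ arc-outer ¬glued ¬inner (inj₁ 1≤i) (inj₂ (+-monoˡ-≤ m i≤n)) ⟩
    arc C (preimage 1) (preimage (n + m))      ≡⟨ cong₂ (arc C) (preimage-before 1≤i) preimage-top ⟩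
    arc C 1 (suc n)                            ∎
    where
    open ≡-Reasoning
    n : ℕ
    n = size C
    ¬glued : ¬ Glued 1 (n + m)
    ¬glued (1≡i , n+m≡i+m) = <⇒≢ 2≤n (trans 1≡i (sym (+-cancelʳ-≡ m n i n+m≡i+m)))
    ¬inner : ¬ Inner 1 (n + m)
    ¬inner (i≤1 , n+m≤i+m) = <⇒≱ 2≤n (≤-trans (+-cancelʳ-≤ m n i n+m≤i+m) i≤1)
    preimage-top : preimage (n + m) ≡ suc n
    preimage-top = begin
      preimage (n + m)                 ≡⟨ cong preimage (trans (cong (_+ m) (sym (m+[n∸m]≡n i≤n))) (+-right-comm i (n ∸ i) m)) ⟩
      preimage (i + m + (n ∸ i))       ≡⟨ preimage-after 1≤m (n ∸ i) ⟩
      suc (i + (n ∸ i))                ≡⟨ cong suc (m+[n∸m]≡n i≤n) ⟩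
      suc n                            ∎

-- The colour condition says that exactly one of the two glued sides is blue.
glue≡none : ∀ {c d} → c ≢ red → d ≢ red →
            (if isBlue d then c₁ else c₂) ≡ (if isBlue c then c₂ else c₁) → glue c d ≡ none
glue≡none {blue} {none} _ _ _ = refl
glue≡none {none} {blue} _ _ _ = refl
glue≡none {blue} {blue} _ _ ()
glue≡none {none} {none} _ _ ()
glue≡none {red}  c≢red _ _ = ⊥-elim (c≢red refl)
glue≡none {_}  {red} _ d≢red _ = ⊥-elim (d≢red refl)

module CompositeOfBubbles {C D : Conf} {i : ℕ} (bC : IsBubble C) (bD : IsBubble D)
                          (1≤i : 1 ≤ i) (i≤n : i ≤ size C) where
  open Composite C D i

  private
    n m N : ℕ
    n = size C
    m = size D
    N = n + m ∸ 1
    comp : Conf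
    comp = C ∘ᶜ⟨ i ⟩ D
    2≤n : 2 ≤ n
    2≤n = IsBNC.size≥2 (IsBubble.isBNC bC)
    2≤m : 2 ≤ m
    2≤m = IsBNC.size≥2 (IsBubble.isBNC bD)
    1≤m : 1 ≤ m
    1≤m = <⇒≤ 2≤m

  1+N≡n+m : suc N ≡ n + m
  1+N≡n+m = m+[n∸m]≡n (≤-trans 1≤m (m≤n+m m n))

  inner-diagonal : ∀ s t → ¬ Glued (i + s) (i + t) → t ≤ m →
                   ValidArc N (i + s) (i + t) → IsDiagonal N (i + s) (i + t) → arc comp (i + s) (i + t) ≡ none
  inner-diagonal s t ¬glued t≤m (_ , s<t , _) (¬edge , _) = begin
    arc comp (i + s) (i + t)                  ≡⟨ arc-inner ¬glued (m≤m+n i s , +-monoʳ-≤ i t≤m) ⟩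
    arc D (suc (i + s ∸ i)) (suc (i + t ∸ i)) ≡⟨ cong₂ (λ a b → arc D (suc a) (suc b)) (m+n∸m≡n i s) (m+n∸m≡n i t) ⟩
    arc D (suc s) (suc t)                     ≡⟨ IsBubble.noDiag bD (suc s) (suc t) (s≤s z≤n , s≤s (+-cancelˡ-< i s t s<t) , s≤s t≤m)
                                                   (¬edge ∘ edge , ¬glued ∘ glued) ⟩
    none                                      ∎
    where
    open ≡-Reasoning
    edge : suc t ≡ suc (suc s) → i + t ≡ suc (i + s)
    edge e = trans (cong (i +_) (suc-injective e)) (+-suc i s)
    glued : (suc s ≡ 1) × (suc t ≡ suc m) → Glued (i + s) (i + t)
    glued (s≡0 , t≡m) = trans (cong (i +_) (suc-injective s≡0)) (+-identityʳ i) , cong (i +_) (suc-injective t≡m)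

  private
    bound : ∀ {t} → i + m + t ≤ suc N → i + t ≤ n
    bound {t} b≤ = +-cancelʳ-≤ m (i + t) n (subst₂ _≤_ (+-right-comm i m t) 1+N≡n+m b≤)

  before-diagonal : ∀ {a b} → ¬ Glued a b → ¬ Inner a b → a ≤ i → b ≤ i →
                    ValidArc N a b → IsDiagonal N a b → arc comp a b ≡ none
  before-diagonal {a} {b} ¬glued ¬inner a≤i b≤i (1≤a , a<b , _) (¬edge , _) = begin
    arc comp a b                        ≡⟨ arc-outer ¬glued ¬inner (inj₁ a≤i) (inj₁ b≤i) ⟩
    arc C (preimage a) (preimage b)     ≡⟨ cong₂ (arc C) (preimage-before a≤i) (preimage-before b≤i) ⟩
    arc C a b                           ≡⟨ IsBubble.noDiag bC a b (1≤a , a<b , m≤n⇒m≤1+n b≤n) (¬edge , ¬base) ⟩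
    none                                ∎
    where
    open ≡-Reasoning
    b≤n : b ≤ n
    b≤n = ≤-trans b≤i i≤n
    ¬base : ¬ ((a ≡ 1) × (b ≡ suc n))
    ¬base (_ , b≡1+n) = <⇒≱ (≤-reflexive (sym b≡1+n)) b≤n

  straddling-diagonal : ∀ {a} t → ¬ Glued a (i + m + t) → ¬ Inner a (i + m + t) → a ≤ i →
                        ValidArc N a (i + m + t) → IsDiagonal N a (i + m + t) → arc comp a (i + m + t) ≡ none
  straddling-diagonal {a} t ¬glued ¬inner a≤i (1≤a , _ , b≤) (_ , ¬base′) = begin
    arc comp a (i + m + t)                          ≡⟨ arc-outer ¬glued ¬inner (inj₁ a≤i) (inj₂ (m≤m+n (i + m) t)) ⟩
    arc C (preimage a) (preimage (i + m + t))       ≡⟨ cong₂ (arc C) (preimage-before a≤i) (preimage-after 1≤m t) ⟩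
    arc C a (suc (i + t))                           ≡⟨ IsBubble.noDiag bC a (suc (i + t))
                                                         (1≤a , s≤s (≤-trans a≤i (m≤m+n i t)) , s≤s (bound b≤)) (¬edge , ¬base) ⟩
    none                                            ∎
    where
    open ≡-Reasoning
    -- an edge here would make a = i and t = 0, i.e. the glued arc
    ¬edge : suc (i + t) ≢ suc a
    ¬edge e = ¬glued (a≡i , trans (cong (i + m +_) t≡0) (+-identityʳ (i + m)))
      where
      a≡i+t : a ≡ i + t
      a≡i+t = sym (suc-injective e)
      t≡0 : t ≡ 0
      t≡0 = n≤0⇒n≡0 (+-cancelˡ-≤ i t 0 (subst₂ _≤_ a≡i+t (sym (+-identityʳ i)) a≤i))
      a≡i : a ≡ i
      a≡i = trans a≡i+t (trans (cong (i +_) t≡0) (+-identityʳ i))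
    ¬base : ¬ ((a ≡ 1) × (suc (i + t) ≡ suc n))
    ¬base (a≡1 , e) = ¬base′ (a≡1 , trans (+-right-comm i m t) (trans (cong (_+ m) (suc-injective e)) (sym 1+N≡n+m)))

  after-diagonal : ∀ s t → ¬ Glued (i + m + s) (i + m + t) → ¬ Inner (i + m + s) (i + m + t) →
                   ValidArc N (i + m + s) (i + m + t) → IsDiagonal N (i + m + s) (i + m + t) →
                   arc comp (i + m + s) (i + m + t) ≡ none
  after-diagonal s t ¬glued ¬inner (_ , a<b , b≤) (¬edge′ , _) = begin
    arc comp (i + m + s) (i + m + t)                      ≡⟨ arc-outer ¬glued ¬inner (inj₂ (m≤m+n (i + m) s)) (inj₂ (m≤m+n (i + m) t)) ⟩
    arc C (preimage (i + m + s)) (preimage (i + m + t))   ≡⟨ cong₂ (arc C) (preimage-after 1≤m s) (preimage-after 1≤m t) ⟩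
    arc C (suc (i + s)) (suc (i + t))                     ≡⟨ IsBubble.noDiag bC (suc (i + s)) (suc (i + t))
                                                               (s≤s z≤n , s≤s (+-monoʳ-< i s<t) , s≤s (bound b≤)) (¬edge , ¬base) ⟩
    none                                                  ∎
    where
    open ≡-Reasoning
    s<t : s < t
    s<t = +-cancelˡ-< (i + m) s t a<b
    ¬edge : suc (i + t) ≢ suc (suc (i + s))
    ¬edge e = ¬edge′ (trans (cong (i + m +_) t≡1+s) (+-suc (i + m) s))
      where
      t≡1+s : t ≡ suc s
      t≡1+s = +-cancelˡ-≡ i t (suc s) (trans (suc-injective e) (sym (+-suc i s)))
    ¬base : ¬ ((suc (i + s) ≡ 1) × (suc (i + t) ≡ suc n))
    ¬base (e , _) = <⇒≱ (≤-trans 1≤i (m≤m+n i s)) (≤-reflexive (suc-injective e))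

  composite-base : arc comp 1 (suc N) ≡ arc C 1 (suc n)
  composite-base = trans (cong (arc comp 1) 1+N≡n+m) (base-arc 2≤n 1≤i i≤n 1≤m)

  composite-edge≢red : ∀ k → 1 ≤ k → k ≤ N → arc comp k (suc k) ≢ red
  composite-edge≢red k 1≤k k≤N with cut (i + m) k
  ... | above u refl =
    subst (_≢ red) (sym (edge-after 1≤m u)) (bubble-edge≢red bC (suc (i + u)) (s≤s z≤n) 1+i+u≤n)
    where
    1+i+u≤n : suc (i + u) ≤ n
    1+i+u≤n = subst (_≤ n) (+-suc i u) (bound (subst (_≤ suc N) (sym (+-suc (i + m) u)) (s≤s k≤N)))
  ... | below k<i+m with cut i k
  ...   | below k<i =
    subst (_≢ red) (sym (edge-before k<i)) (bubble-edge≢red bC k 1≤k (≤-trans (<⇒≤ k<i) i≤n))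
  ...   | above t refl =
    subst (_≢ red) (sym (edge-inner 2≤m t<m)) (bubble-edge≢red bD (suc t) (s≤s z≤n) t<m)
    where
    t<m : t < m
    t<m = +-cancelˡ-< i t m k<i+m

  composite-noDiag : Out (bnc D) ≡ In (bnc C) i →
                     ∀ a b → ValidArc N a b → IsDiagonal N a b → arc comp a b ≡ none
  composite-noDiag colours a b valid diag with glued? a b
  ... | yes glued = trans (arc-glued glued) (glue≡none (bubble-edge≢red bC i 1≤i i≤n) (bubble-base≢red bD) colours)
  ... | no ¬glued with inner? a b
  ...   | yes (i≤a , b≤i+m) with m≤n⇒∃[o]m+o≡n i≤a | m≤n⇒∃[o]m+o≡n (≤-trans i≤a (<⇒≤ (proj₁ (proj₂ valid))))
  ...     | s , refl | t , refl = inner-diagonal s t ¬glued (+-cancelˡ-≤ i t m b≤i+m) valid diag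
  composite-noDiag colours a b valid diag | no ¬glued | no ¬inner with outer? a | outer? b
  ... | no ¬outer | _      = arc-elsewhere ¬glued ¬inner (¬outer ∘ proj₁)
  ... | yes _     | no ¬outer = arc-elsewhere ¬glued ¬inner (¬outer ∘ proj₂)
  ... | yes (inj₁ a≤i) | yes (inj₁ b≤i) = before-diagonal ¬glued ¬inner a≤i b≤i valid diag
  ... | yes (inj₁ a≤i) | yes (inj₂ i+m≤b) with m≤n⇒∃[o]m+o≡n i+m≤b
  ...   | t , refl = straddling-diagonal t ¬glued ¬inner a≤i valid diag
  composite-noDiag colours a b valid diag | no ¬glued | no ¬inner | yes (inj₂ i+m≤a) | yes (inj₁ b≤i) =
    ⊥-elim (<⇒≱ (proj₁ (proj₂ valid)) (≤-trans b≤i (≤-trans (m≤m+n i m) i+m≤a)))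
  composite-noDiag colours a b valid diag | no ¬glued | no ¬inner | yes (inj₂ i+m≤a) | yes (inj₂ i+m≤b)
    with m≤n⇒∃[o]m+o≡n i+m≤a | m≤n⇒∃[o]m+o≡n i+m≤b
  ... | s , refl | t , refl = after-diagonal s t ¬glued ¬inner valid diag

  composite-isBubble : Out (bnc D) ≡ In (bnc C) i → IsBubble comp
  composite-isBubble colours =
    isBubble comp 2≤N (composite-noDiag colours) composite-edge≢red
             (bubble-base≢red bC ∘ trans (sym composite-base))
    where
    2≤N : 2 ≤ N
    2≤N = ≤-trans 2≤n (≤-pred (subst (suc n ≤_) (sym 1+N≡n+m) (subst (_≤ n + m) (+-comm n 1) (+-monoʳ-≤ n 1≤m))))

if-injective : ∀ {A : Set} {a b : A} → a ≢ b → ∀ {x y} → (if x then a else b) ≡ (if y then a else b) → x ≡ y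
if-injective _   {true}  {true}  _ = refl
if-injective _   {false} {false} _ = refl
if-injective a≢b {true}  {false} e = ⊥-elim (a≢b e)
if-injective a≢b {false} {true}  e = ⊥-elim (a≢b (sym e))

bulle-arity≥1 : ∀ x → IsElt x → 1 ≤ ar x
bulle-arity≥1 (unit _) _ = ≤-refl
bulle-arity≥1 (bnc _)  b = <⇒≤ (IsBNC.size≥2 (IsBubble.isBNC b))

bulle-comp-el : ∀ x y i → IsElt x → IsElt y → 1 ≤ i → i ≤ ar x → Out y ≡ In x i → IsElt (x ∘⟨ i ⟩ y)
bulle-comp-el (unit _) _        _ _   el-y _   _   _       = el-y
bulle-comp-el (bnc _)  (unit _) _ el-x _    _   _   _       = el-x
bulle-comp-el (bnc _)  (bnc _)  _ el-x el-y 1≤i i≤n colours =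
  CompositeOfBubbles.composite-isBubble el-x el-y 1≤i i≤n colours

bulle-comp-ar : ∀ x y i → IsElt x → IsElt y → 1 ≤ i → i ≤ ar x → Out y ≡ In x i →
                ar (x ∘⟨ i ⟩ y) ≡ ar x + ar y ∸ 1
bulle-comp-ar (unit _) _        _ _ _ _ _ _ = refl
bulle-comp-ar (bnc C)  (unit _) _ _ _ _ _ _ = sym (m+n∸n≡m (size C) 1)
bulle-comp-ar (bnc _)  (bnc _)  _ _ _ _ _ _ = refl

bulle-comp-out : ∀ x y i → IsElt x → IsElt y → 1 ≤ i → i ≤ ar x → Out y ≡ In x i →
                 Out (x ∘⟨ i ⟩ y) ≡ Out x
bulle-comp-out (unit _) _        _ _    _    _   _   colours = colours
bulle-comp-out (bnc _)  (unit _) _ _    _    _   _   _       = refl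
bulle-comp-out (bnc _)  (bnc _)  _ el-x el-y 1≤i i≤n _       =
  cong (λ c → if isBlue c then c₁ else c₂) (CompositeOfBubbles.composite-base el-x el-y 1≤i i≤n)

bulle-comp-inˡ : ∀ x y i k → IsElt x → IsElt y → 1 ≤ i → i ≤ ar x → Out y ≡ In x i →
                 1 ≤ k → k < i → In (x ∘⟨ i ⟩ y) k ≡ In x k
bulle-comp-inˡ (unit _) _        _ _ _ _ _ i≤1 _ 1≤k k<i = ⊥-elim (<⇒≱ k<i (≤-trans i≤1 1≤k))
bulle-comp-inˡ (bnc _)  (unit _) _ _ _ _ _ _   _ _   _   = refl
bulle-comp-inˡ (bnc C)  (bnc D)  i _ _ _ _ _   _ _   k<i =
  cong (λ c → if isBlue c then c₂ else c₁) (Composite.edge-before C D i k<i)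

bulle-comp-inᵐ : ∀ x y i k → IsElt x → IsElt y → 1 ≤ i → i ≤ ar x → Out y ≡ In x i →
                 i ≤ k → k < i + ar y → In (x ∘⟨ i ⟩ y) k ≡ In y (suc (k ∸ i))
bulle-comp-inᵐ (unit _) y        i k _ _ 1≤i i≤1 _ i≤k _ with ≤-antisym i≤1 1≤i
... | refl = cong (In y) (sym (m+[n∸m]≡n i≤k))
bulle-comp-inᵐ (bnc C)  (unit _) i k _ _ _ _ colours i≤k k<i+1 =
  trans (cong (In (bnc C)) (≤-antisym (≤-pred (subst (k <_) (+-comm i 1) k<i+1)) i≤k)) (sym colours)
bulle-comp-inᵐ (bnc C)  (bnc D)  i k _ el-D _ _ _ i≤k k<i+m with m≤n⇒∃[o]m+o≡n i≤k
... | t , refl = trans (cong (λ c → if isBlue c then c₂ else c₁) (Composite.edge-inner C D i 2≤m t<m))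
                       (cong (In (bnc D) ∘ suc) (sym (m+n∸m≡n i t)))
  where
  2≤m : 2 ≤ size D
  2≤m = IsBNC.size≥2 (IsBubble.isBNC el-D)
  t<m : t < size D
  t<m = +-cancelˡ-< i t (size D) k<i+m

bulle-comp-inʳ : ∀ x y i k → IsElt x → IsElt y → 1 ≤ i → i ≤ ar x → Out y ≡ In x i →
                 i + ar y ≤ k → k ≤ ar x + ar y ∸ 1 → In (x ∘⟨ i ⟩ y) k ≡ In x (k + 1 ∸ ar y)
bulle-comp-inʳ (unit _) y        i k _ _ 1≤i _ _ i+m≤k k≤m = ⊥-elim (<⇒≱ (<-≤-trans (+-monoˡ-≤ (ar y) 1≤i) i+m≤k) k≤m)
bulle-comp-inʳ (bnc C)  (unit _) i k _ _ _ _ _ _ _ = cong (In (bnc C)) (sym (m+n∸n≡m k 1))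
bulle-comp-inʳ (bnc C)  (bnc D)  i k _ el-D _ _ _ i+m≤k _ with m≤n⇒∃[o]m+o≡n i+m≤k
... | t , refl = trans (cong (λ c → if isBlue c then c₂ else c₁) (Composite.edge-after C D i 1≤m t))
                       (cong (In (bnc C)) (sym (a+b+c+1∸b≡1+a+c i (size D) t)))
  where
  1≤m : 1 ≤ size D
  1≤m = bulle-arity≥1 (bnc D) el-D

bulle-ext : ∀ x y → IsElt x → IsElt y → ar x ≡ ar y → Out x ≡ Out y →
            (∀ k → 1 ≤ k → k ≤ ar x → In x k ≡ In y k) → x ≈ y
bulle-ext (unit _) (unit _) _    _    _  out _ = out
bulle-ext (unit _) (bnc _)  _    el-D ar _   _ = <⇒≱ (IsBNC.size≥2 (IsBubble.isBNC el-D)) (≤-reflexive (sym ar))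
bulle-ext (bnc _)  (unit _) el-C _    ar _   _ = <⇒≱ (IsBNC.size≥2 (IsBubble.isBNC el-C)) (≤-reflexive ar)
bulle-ext (bnc _)  (bnc _)  el-C el-D ar out inp =
  bubble-ext el-C el-D ar (if-injective (λ ()) out) (λ k 1≤k k≤n → if-injective (λ ()) (inp k 1≤k k≤n))

bulle-isProfileDetermined : IsProfileDetermined IsElt _≈_ ar Out In _∘⟨_⟩_
bulle-isProfileDetermined = record
  { arity≥1     = bulle-arity≥1
  ; comp-el     = bulle-comp-el
  ; comp-ar     = bulle-comp-ar
  ; comp-out    = bulle-comp-out
  ; comp-inˡ    = bulle-comp-inˡ
  ; comp-inᵐ    = bulle-comp-inᵐ
  ; comp-inʳ    = bulle-comp-inʳ
  ; profile-ext = bulle-ext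
  }

≈-refl : ∀ x → x ≈ x
≈-refl (unit _) = refl
≈-refl (bnc _)  = refl , λ _ _ _ → refl

bulle-isOperad : Is2ColouredOperad IsElt _≈_ ar Out In _∘⟨_⟩_ 𝟙
bulle-isOperad = record
  { arity≥1    = bulle-arity≥1
  ; unit-el    = λ _ → tt
  ; unit-ar    = λ _ → refl
  ; unit-out   = λ _ → refl
  ; unit-in    = λ _ → refl
  ; comp-el    = bulle-comp-el
  ; comp-ar    = bulle-comp-ar
  ; comp-out   = bulle-comp-out
  ; comp-inˡ   = bulle-comp-inˡ
  ; comp-inᵐ   = bulle-comp-inᵐ
  ; comp-inʳ   = bulle-comp-inʳ
  ; assoc-seq  = assoc-seq
  ; assoc-par  = assoc-par
  ; unit-left  = λ x _ → ≈-refl x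
  ; unit-right = unit-right
  }
  where
  open ProfileAssociativity bulle-isProfileDetermined using (assoc-seq; assoc-par)
  unit-right : ∀ x i → IsElt x → 1 ≤ i → i ≤ ar x → (x ∘⟨ i ⟩ 𝟙 (In x i)) ≈ x
  unit-right (unit _) _ _ _ _ = refl
  unit-right (bnc C)  _ _ _ _ = ≈-refl (bnc C)

mainTheorem5 : Is2ColouredOperad IsElt _≈_ ar Out In _∘⟨_⟩_ 𝟙
               × (∀ (B₁ B₂ : Conf) (i : ℕ) → IsBubble B₁ → IsBubble B₂ →
                    1 ≤ i → i ≤ size B₁ → Out (bnc B₂) ≡ In (bnc B₁) i →
                    IsBubble (B₁ ∘ᶜ⟨ i ⟩ B₂))
mainTheorem5 = bulle-isOperad , λ _ _ _ b₁ b₂ 1≤i i≤n colours →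
  CompositeOfBubbles.composite-isBubble b₁ b₂ 1≤i i≤n colours
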